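{- For $n\ge 5$, there is an absolute constant $c>0$ such that there exists a red/blue coloring $\phi$ of the pairs of $\{0,1,\ldots,\lfloor 2^{cn}\rfloor-1\}$ such that every $n$-element set $A\subset\{0,1,\ldots,\lfloor 2^{cn}\rfloor-1\}$ contains a $4$-tuple $a_i<a_j<a_k<a_\ell$ of elements of $A$ satisfying \[ \phi(a_i,a_k)=\phi(a_j,a_\ell)=\text{red},\qquad \phi(a_i,a_j)=\phi(a_j,a_k)=\phi(a_k,a_\ell)=\text{blue}. \] -}

module Defs where

open import Data.Nat using (ℕ; _<_; _≤_; _^_; _*_; suc)
open import Data.Fin using (Fin)
open import Data.Product using (_×_; ∃-syntax)
open import Relation.Binary.PropositionalEquality using (_≡_)
open import Function.Definitions using (Injective)

data Colour : Set where
  red blue : Colour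

-- A red/blue colouring of the pairs of {0,…,N-1}: a function on ℕ × ℕ,
-- only ever evaluated at (x , y) with x < y (so it is a colouring of
-- unordered pairs {x,y} via (min , max)).
Colouring : Set
Colouring = ℕ → ℕ → Colour

-- N = ⌊ 2^(c n) ⌋ with c = p / q  (q ≥ 1):  N^q ≤ 2^(p n) < (N+1)^q.
IsFloorPow2 : (p q n N : ℕ) → Set
IsFloorPow2 p q n N = (N ^ q ≤ 2 ^ (p * n)) × (2 ^ (p * n) < suc N ^ q)

IsNSubset : (N n : ℕ) → (Fin n → ℕ) → Set
IsNSubset N n A = Injective _≡_ _≡_ A × (∀ i → A i < N)

HasPattern : Colouring → (n : ℕ) → (Fin n → ℕ) → Set
HasPattern φ n A =
  ∃[ i ] ∃[ j ] ∃[ k ] ∃[ l ]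
    (A i < A j) × (A j < A k) × (A k < A l) ×
    (φ (A i) (A k) ≡ red) × (φ (A j) (A l) ≡ red) ×
    (φ (A i) (A j) ≡ blue) × (φ (A j) (A k) ≡ blue) × (φ (A k) (A l) ≡ blue)

-- A counting form of the probabilistic argument.  Colour the N² pairs at random.  In an increasing
-- sequence s of length n put m = ⌊n/7⌋ and, for a, b < m, take the quadruple of s at positions
-- a < m+b < 2m+a+b < 4m+a+2b.  Different (a, b) use disjoint sets of five pairs, so the m²
-- quadruples are coloured independently and each misses the pattern with probability 31/32.
-- Summed over all N^n sequences, the expected number of pattern-free n-sets is at most
-- N^n (31/32)^(m²), which is below 1 once N^4312 ≤ 2^n.  Probabilities are replaced by exact
-- counts over all 2^(N²) colourings.
module Submission where

open import Defs
import Algebra.Properties.CommutativeSemigroup as CommutativeSemigroupProperties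
open import Data.Bool using (Bool; true; false; if_then_else_)
open import Data.Empty using (⊥-elim)
open import Data.Fin using (Fin; toℕ) renaming (zero to fzero; suc to fsuc)
open import Data.Fin.Properties using (toℕ<n; toℕ-injective)
open import Data.List as List using (List; []; _∷_; _++_; length; allFin; cartesianProduct)
open import Data.List.Membership.Propositional using (_∈_)
open import Data.List.Membership.Propositional.Properties using (∈-tabulate⁻)
open import Data.List.Properties using (length-map; length-++; length-tabulate)
open import Data.List.Relation.Binary.Permutation.Propositional.Properties using (↭-length; ∈-resp-↭)
import Data.List.Relation.Binary.Permutation.Setoid as SetoidPermutation
import Data.List.Relation.Binary.Permutation.Setoid.Properties as SetoidPermutationProperties
open import Data.List.Relation.Unary.All as All using (All; []; _∷_)
import Data.List.Relation.Unary.All.Properties as Allₚ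
open import Data.List.Relation.Unary.AllPairs as AllPairs using (AllPairs; []; _∷_)
import Data.List.Relation.Unary.AllPairs.Properties as AllPairsₚ
open import Data.List.Relation.Unary.Any as Any using (Any; here; there)
open import Data.List.Relation.Unary.Any.Properties using (map⁻)
open import Data.List.Relation.Unary.Linked using (Linked; []; [-]; _∷_; linked?)
import Data.List.Relation.Unary.Unique.Propositional as ListUnique
open import Data.List.Relation.Unary.Unique.Propositional.Properties using (tabulate⁺; cartesianProduct⁺; allFin⁺)
open import Data.List.Sort.Base using (SortingAlgorithm)
open import Data.Nat using (ℕ; zero; suc; _+_; _*_; _∸_; _^_; _<_; _≤_; z≤n; s≤s; s≤s⁻¹; z<s; _<?_; _≤?_)
open import Data.Nat.DivMod using (_/_; _%_; m≡m%n+[m/n]*n; m%n<n; m/n*n≤m; m≥n⇒m/n>0)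
open import Data.Nat.ListAction using (product)
open import Data.Nat.Properties
open import Data.Nat.Tactic.RingSolver using (solve-∀)
open import Data.List.Sort ≤-decTotalOrder using (sort; sort-↭; sort-↗; sortingAlgorithm)
open import Data.Product using (_×_; _,_; proj₁; proj₂; ∃-syntax)
open import Data.Product.Properties using (,-injective)
open import Data.Sum using (inj₁; inj₂)
open import Data.Unit using (tt)
open import Data.Vec as Vec using (Vec; []; _∷_)
open import Data.Vec.Membership.Propositional using () renaming (_∈_ to _∈ᵛ_)
open import Data.Vec.Relation.Unary.All as VecAll using ([]; _∷_)
import Data.Vec.Relation.Unary.All.Properties as VecAllₚ
open import Data.Vec.Relation.Unary.AllPairs using ([]; _∷_)
open import Data.Vec.Relation.Unary.Any using (here; there)
open import Data.Vec.Relation.Unary.Unique.Propositional using (Unique)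
import Data.Vec.Relation.Unary.Unique.Propositional.Properties as VecUnique
open import Function using (_∘_; id)
open import Function.Definitions using (Injective)
open import Relation.Binary using (tri<; tri≈; tri>)
open import Relation.Binary.PropositionalEquality
open import Relation.Nullary using (¬_; Dec; yes; no; does)
open import Relation.Nullary.Decidable using (dec-true; dec-false; _×-dec_)

open CommutativeSemigroupProperties +-commutativeSemigroup using (interchange)
open CommutativeSemigroupProperties *-commutativeSemigroup using (xy∙z≈y∙xz; x∙yz≈y∙xz)


bit : ∀ {K} → Vec Bool K → ℕ → Bool
bit []      _       = false
bit (x ∷ v) zero    = x
bit (x ∷ v) (suc c) = bit v c

setBit : ∀ {K} → Vec Bool K → ℕ → Bool → Vec Bool K
setBit []      _       _ = []
setBit (x ∷ v) zero    b = b ∷ v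
setBit (x ∷ v) (suc c) b = x ∷ setBit v c b

bit-setBit-≡ : ∀ {K} (v : Vec Bool K) {c} b → c < K → bit (setBit v c b) c ≡ b
bit-setBit-≡ (x ∷ v) {zero}  b _       = refl
bit-setBit-≡ (x ∷ v) {suc c} b (s≤s p) = bit-setBit-≡ v b p

bit-setBit-≢ : ∀ {K} (v : Vec Bool K) {c d} b → c ≢ d → bit (setBit v c b) d ≡ bit v d
bit-setBit-≢ []      b c≢d = refl
bit-setBit-≢ (x ∷ v) {zero}  {zero}  b c≢d = ⊥-elim (c≢d refl)
bit-setBit-≢ (x ∷ v) {zero}  {suc d} b c≢d = refl
bit-setBit-≢ (x ∷ v) {suc c} {zero}  b c≢d = refl
bit-setBit-≢ (x ∷ v) {suc c} {suc d} b c≢d = bit-setBit-≢ v b (c≢d ∘ cong suc)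

cubeSum : (K : ℕ) → (Vec Bool K → ℕ) → ℕ
cubeSum zero    f = f []
cubeSum (suc K) f = cubeSum K (λ v → f (false ∷ v)) + cubeSum K (λ v → f (true ∷ v))

cubeSum-cong : ∀ K {f g : Vec Bool K → ℕ} → (∀ v → f v ≡ g v) → cubeSum K f ≡ cubeSum K g
cubeSum-cong zero    f≗g = f≗g []
cubeSum-cong (suc K) f≗g =
  cong₂ _+_ (cubeSum-cong K (λ v → f≗g (false ∷ v))) (cubeSum-cong K (λ v → f≗g (true ∷ v)))

cubeSum-+ : ∀ K (f g : Vec Bool K → ℕ) → cubeSum K (λ v → f v + g v) ≡ cubeSum K f + cubeSum K g
cubeSum-+ zero    f g = refl
cubeSum-+ (suc K) f g = begin
  cubeSum K (λ v → f (false ∷ v) + g (false ∷ v)) + cubeSum K (λ v → f (true ∷ v) + g (true ∷ v))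
    ≡⟨ cong₂ _+_ (cubeSum-+ K _ _) (cubeSum-+ K _ _) ⟩
  (cubeSum K (λ v → f (false ∷ v)) + cubeSum K (λ v → g (false ∷ v))) +
  (cubeSum K (λ v → f (true ∷ v)) + cubeSum K (λ v → g (true ∷ v)))
    ≡⟨ interchange f₀ g₀ f₁ g₁ ⟩
  cubeSum (suc K) f + cubeSum (suc K) g ∎
  where
  open ≡-Reasoning
  f₀ g₀ f₁ g₁ : ℕ
  f₀ = cubeSum K (λ v → f (false ∷ v))
  g₀ = cubeSum K (λ v → g (false ∷ v))
  f₁ = cubeSum K (λ v → f (true ∷ v))
  g₁ = cubeSum K (λ v → g (true ∷ v))

cubeSum-* : ∀ K c (f : Vec Bool K → ℕ) → cubeSum K (λ v → c * f v) ≡ c * cubeSum K f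
cubeSum-* zero    c f = refl
cubeSum-* (suc K) c f =
  trans (cong₂ _+_ (cubeSum-* K c _) (cubeSum-* K c _)) (sym (*-distribˡ-+ c _ _))

cubeSum-0 : ∀ K → cubeSum K (λ _ → 0) ≡ 0
cubeSum-0 zero    = refl
cubeSum-0 (suc K) = cong₂ _+_ (cubeSum-0 K) (cubeSum-0 K)

cubeSum-1 : ∀ K → cubeSum K (λ _ → 1) ≡ 2 ^ K
cubeSum-1 zero    = refl
cubeSum-1 (suc K) = trans (cong₂ _+_ (cubeSum-1 K) (cubeSum-1 K)) (cong (2 ^ K +_) (sym (+-identityʳ _)))

cubeSum-<⇒∃≡0 : ∀ K (f : Vec Bool K → ℕ) → cubeSum K f < 2 ^ K → ∃[ v ] f v ≡ 0
cubeSum-<⇒∃≡0 zero    f sum<1 = [] , n<1⇒n≡0 sum<1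
cubeSum-<⇒∃≡0 (suc K) f sum<2^[1+K] with cubeSum K (λ v → f (false ∷ v)) <? 2 ^ K
... | yes sum₀<2^K = let v , fv≡0 = cubeSum-<⇒∃≡0 K _ sum₀<2^K in false ∷ v , fv≡0
... | no  sum₀≮2^K = let v , fv≡0 = cubeSum-<⇒∃≡0 K _ sum₁<2^K in true ∷ v , fv≡0
  where
  sum₁<2^K : cubeSum K (λ v → f (true ∷ v)) < 2 ^ K
  sum₁<2^K = +-cancelˡ-< (2 ^ K) _ _ (≤-<-trans (+-monoˡ-≤ _ (≮⇒≥ sum₀≮2^K))
    (<-≤-trans sum<2^[1+K] (≤-reflexive (cong (2 ^ K +_) (+-identityʳ (2 ^ K))))))

cubeSum-setBit : ∀ K {c} (f : Vec Bool K → ℕ) → c < K →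
  cubeSum K (λ v → f (setBit v c false) + f (setBit v c true)) ≡ 2 * cubeSum K f
cubeSum-setBit (suc K) {zero} f _ = begin
  S + S                ≡⟨ cong (λ x → x + x) (cubeSum-+ K _ _) ⟩
  f₀ + f₁ + (f₀ + f₁)  ≡⟨ cong (f₀ + f₁ +_) (sym (+-identityʳ _)) ⟩
  2 * (f₀ + f₁)        ∎
  where
  open ≡-Reasoning
  S f₀ f₁ : ℕ
  S  = cubeSum K (λ w → f (false ∷ w) + f (true ∷ w))
  f₀ = cubeSum K (λ w → f (false ∷ w))
  f₁ = cubeSum K (λ w → f (true ∷ w))
cubeSum-setBit (suc K) {suc c} f (s≤s c<K) =
  trans (cong₂ _+_ (cubeSum-setBit K (λ w → f (false ∷ w)) c<K) (cubeSum-setBit K (λ w → f (true ∷ w)) c<K))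
        (sym (*-distribˡ-+ 2 (cubeSum K (λ w → f (false ∷ w))) _))

-- resample cs f v sums f over the 2^L vectors that agree with v outside the coordinates cs.
resample : ∀ {K L} → Vec ℕ L → (Vec Bool K → ℕ) → Vec Bool K → ℕ
resample []       f v = f v
resample (c ∷ cs) f v = resample cs f (setBit v c false) + resample cs f (setBit v c true)

cubeSum-resample : ∀ K {L} (cs : Vec ℕ L) (f : Vec Bool K → ℕ) → VecAll.All (_< K) cs →
  cubeSum K (resample cs f) ≡ 2 ^ L * cubeSum K f
cubeSum-resample K []               f []              = sym (+-identityʳ _)
cubeSum-resample K {suc L} (c ∷ cs) f (c<K ∷ cs<K) = begin
  cubeSum K (λ v → resample cs f (setBit v c false) + resample cs f (setBit v c true))
    ≡⟨ cubeSum-setBit K (resample cs f) c<K ⟩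
  2 * cubeSum K (resample cs f)
    ≡⟨ cong (2 *_) (cubeSum-resample K cs f cs<K) ⟩
  2 * (2 ^ L * cubeSum K f)
    ≡⟨ sym (*-assoc 2 (2 ^ L) _) ⟩
  2 ^ suc L * cubeSum K f ∎
  where open ≡-Reasoning

resample-cong : ∀ {K L} (cs : Vec ℕ L) {c b} {f g : Vec Bool K → ℕ} {u : Vec Bool K} →
  VecAll.All (c ≢_) cs → bit u c ≡ b → (∀ w → bit w c ≡ b → f w ≡ g w) →
  resample cs f u ≡ resample cs g u
resample-cong []       _                 uc≡b f≗g = f≗g _ uc≡b
resample-cong (d ∷ cs) {u = u} (c≢d ∷ c∉cs) uc≡b f≗g =
  cong₂ _+_ (resample-cong cs c∉cs (trans (bit-setBit-≢ u false (c≢d ∘ sym)) uc≡b) f≗g)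
            (resample-cong cs c∉cs (trans (bit-setBit-≢ u true  (c≢d ∘ sym)) uc≡b) f≗g)

restrict : ∀ {K L} → Vec Bool K → Vec ℕ L → Vec Bool L
restrict v cs = Vec.map (bit v) cs

restrict-setBit : ∀ {K L} (w : Vec Bool K) {d} b (cs : Vec ℕ L) →
  VecAll.All (d ≢_) cs → restrict (setBit w d b) cs ≡ restrict w cs
restrict-setBit w b []       []                   = refl
restrict-setBit w b (c ∷ cs) (d≢c ∷ d∉cs) =
  cong₂ _∷_ (bit-setBit-≢ w b d≢c) (restrict-setBit w b cs d∉cs)

resample-restrict : ∀ {K L} (cs : Vec ℕ L) (G : Vec Bool L → ℕ) (v : Vec Bool K) →
  VecAll.All (_< K) cs → Unique cs → resample cs (λ w → G (restrict w cs)) v ≡ cubeSum L G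
resample-restrict []               G v []                  []                = refl
resample-restrict {K} {suc L} (c ∷ cs) G v (c<K ∷ cs<K) (c∉cs ∷ cs-unique) =
  cong₂ _+_ (fixing false) (fixing true)
  where
  fixing : ∀ b → resample cs (λ w → G (bit w c ∷ restrict w cs)) (setBit v c b)
               ≡ cubeSum L (λ σ → G (b ∷ σ))
  fixing b = trans
    (resample-cong cs c∉cs (bit-setBit-≡ v b c<K) (λ w wc≡b → cong (λ x → G (x ∷ restrict w cs)) wc≡b))
    (resample-restrict cs (λ σ → G (b ∷ σ)) (setBit v c b) cs<K cs-unique)

resample-factor : ∀ {K L} (cs : Vec ℕ L) (g P : Vec Bool K → ℕ) (v : Vec Bool K) →
  (∀ {d} → d ∈ᵛ cs → ∀ w b → P (setBit w d b) ≡ P w) →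
  resample cs (λ w → g w * P w) v ≡ resample cs g v * P v
resample-factor []       g P v _         = refl
resample-factor (d ∷ cs) g P v P-invariant = begin
  resample cs (λ w → g w * P w) v₀ + resample cs (λ w → g w * P w) v₁
    ≡⟨ cong₂ _+_ (resample-factor cs g P v₀ (λ d∈cs → P-invariant (there d∈cs)))
                 (resample-factor cs g P v₁ (λ d∈cs → P-invariant (there d∈cs))) ⟩
  resample cs g v₀ * P v₀ + resample cs g v₁ * P v₁
    ≡⟨ cong₂ (λ x y → resample cs g v₀ * x + resample cs g v₁ * y)
             (P-invariant (here refl) v false) (P-invariant (here refl) v true) ⟩
  resample cs g v₀ * P v + resample cs g v₁ * P v
    ≡⟨ sym (*-distribʳ-+ (P v) (resample cs g v₀) _) ⟩
  (resample cs g v₀ + resample cs g v₁) * P v ∎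
  where
  open ≡-Reasoning
  v₀ v₁ : Vec Bool _
  v₀ = setBit v d false
  v₁ = setBit v d true

Disjoint : ∀ {L M} → Vec ℕ L → Vec ℕ M → Set
Disjoint cs ds = VecAll.All (λ c → VecAll.All (c ≢_) ds) cs

blockProduct : ∀ {K L} → (Vec Bool L → ℕ) → List (Vec ℕ L) → Vec Bool K → ℕ
blockProduct G bs v = product (List.map (λ cs → G (restrict v cs)) bs)

blockProduct-setBit : ∀ {K L} (G : Vec Bool L → ℕ) (bs : List (Vec ℕ L)) {d} (w : Vec Bool K) b →
  All (VecAll.All (d ≢_)) bs → blockProduct G bs (setBit w d b) ≡ blockProduct G bs w
blockProduct-setBit G []       w b []                   = refl
blockProduct-setBit G (cs ∷ bs) w b (d∉cs ∷ d∉bs) =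
  cong₂ _*_ (cong G (restrict-setBit w b cs d∉cs)) (blockProduct-setBit G bs w b d∉bs)

-- Averaging over the coordinates of the first block factors out its sum, because the product over
-- the remaining blocks does not read them.
cubeSum-blockProduct : ∀ K {L} (G : Vec Bool L → ℕ) (bs : List (Vec ℕ L)) →
  All (VecAll.All (_< K)) bs → All Unique bs → AllPairs Disjoint bs →
  (2 ^ L) ^ length bs * cubeSum K (blockProduct G bs) ≡ cubeSum L G ^ length bs * 2 ^ K
cubeSum-blockProduct K G [] _ _ _ = trans (+-identityʳ _) (trans (cubeSum-1 K) (sym (+-identityʳ _)))
cubeSum-blockProduct K {L} G (cs ∷ bs) (cs<K ∷ bs<K) (cs-unique ∷ bs-unique) (cs#bs ∷ bs-disjoint) = begin
  (2 ^ L * C) * cubeSum K (λ v → Gᶜˢ v * Π v)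
    ≡⟨ xy∙z≈y∙xz (2 ^ L) C _ ⟩
  C * (2 ^ L * cubeSum K (λ v → Gᶜˢ v * Π v))
    ≡⟨ cong (C *_) (sym (cubeSum-resample K cs _ cs<K)) ⟩
  C * cubeSum K (resample cs (λ v → Gᶜˢ v * Π v))
    ≡⟨ cong (C *_) (cubeSum-cong K (λ v → resample-factor cs Gᶜˢ Π v Π-invariant)) ⟩
  C * cubeSum K (λ v → resample cs Gᶜˢ v * Π v)
    ≡⟨ cong (C *_) (cubeSum-cong K (λ v → cong (_* Π v) (resample-restrict cs G v cs<K cs-unique))) ⟩
  C * cubeSum K (λ v → S * Π v)
    ≡⟨ cong (C *_) (cubeSum-* K S Π) ⟩
  C * (S * cubeSum K Π)
    ≡⟨ x∙yz≈y∙xz C S _ ⟩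
  S * (C * cubeSum K Π)
    ≡⟨ cong (S *_) (cubeSum-blockProduct K G bs bs<K bs-unique bs-disjoint) ⟩
  S * (S ^ length bs * 2 ^ K)
    ≡⟨ sym (*-assoc S _ _) ⟩
  S * S ^ length bs * 2 ^ K ∎
  where
  open ≡-Reasoning
  C S : ℕ
  C = (2 ^ L) ^ length bs
  S = cubeSum L G
  Gᶜˢ : Vec Bool K → ℕ
  Gᶜˢ v = G (restrict v cs)
  Π : Vec Bool K → ℕ
  Π = blockProduct G bs
  Π-invariant : ∀ {d} → d ∈ᵛ cs → ∀ w b → Π (setBit w d b) ≡ Π w
  Π-invariant d∈cs w b = blockProduct-setBit G bs w b (All.map (λ cs#ds → VecAll.lookup cs#ds d∈cs) cs#bs)

rangeSum : ℕ → (ℕ → ℕ) → ℕ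
rangeSum zero    f = 0
rangeSum (suc N) f = f N + rangeSum N f

rangeSum-cong : ∀ N {f g : ℕ → ℕ} → (∀ x → f x ≡ g x) → rangeSum N f ≡ rangeSum N g
rangeSum-cong zero    f≗g = refl
rangeSum-cong (suc N) f≗g = cong₂ _+_ (f≗g N) (rangeSum-cong N f≗g)

≤-rangeSum : ∀ N (f : ℕ → ℕ) {x} → x < N → f x ≤ rangeSum N f
≤-rangeSum (suc N) f x<1+N with m≤n⇒m<n∨m≡n (s≤s⁻¹ x<1+N)
... | inj₁ x<N  = ≤-trans (≤-rangeSum N f x<N) (m≤n+m _ (f N))
... | inj₂ refl = m≤m+n _ _

*-rangeSum-≤ : ∀ N c B (f : ℕ → ℕ) → (∀ x → c * f x ≤ B) → c * rangeSum N f ≤ N * B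
*-rangeSum-≤ zero    c B f cf≤B = ≤-reflexive (*-zeroʳ c)
*-rangeSum-≤ (suc N) c B f cf≤B =
  ≤-trans (≤-reflexive (*-distribˡ-+ c (f N) _)) (+-mono-≤ (cf≤B N) (*-rangeSum-≤ N c B f cf≤B))

cubeSum-rangeSum : ∀ K N (F : ℕ → Vec Bool K → ℕ) →
  cubeSum K (λ v → rangeSum N (λ x → F x v)) ≡ rangeSum N (λ x → cubeSum K (F x))
cubeSum-rangeSum K zero    F = cubeSum-0 K
cubeSum-rangeSum K (suc N) F =
  trans (cubeSum-+ K (F N) _) (cong (cubeSum K (F N) +_) (cubeSum-rangeSum K N F))

seqSum : ℕ → ℕ → (List ℕ → ℕ) → ℕ
seqSum zero    N T = T []
seqSum (suc n) N T = rangeSum N (λ x → seqSum n N (λ s → T (x ∷ s)))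

≤-seqSum : ∀ n N (T : List ℕ → ℕ) {s} → length s ≡ n → All (_< N) s → T s ≤ seqSum n N T
≤-seqSum zero    N T {[]}    refl []           = ≤-refl
≤-seqSum (suc n) N T {x ∷ s} refl (x<N ∷ s<N) =
  ≤-trans (≤-seqSum n N (λ s′ → T (x ∷ s′)) refl s<N)
          (≤-rangeSum N (λ y → seqSum n N (λ s′ → T (y ∷ s′))) x<N)

*-seqSum-≤ : ∀ n N c B (T : List ℕ → ℕ) → (∀ s → length s ≡ n → c * T s ≤ B) →
  c * seqSum n N T ≤ N ^ n * B
*-seqSum-≤ zero    N c B T cT≤B = ≤-trans (cT≤B [] refl) (≤-reflexive (sym (+-identityʳ B)))
*-seqSum-≤ (suc n) N c B T cT≤B = ≤-trans
  (*-rangeSum-≤ N c (N ^ n * B) _ (λ x → *-seqSum-≤ n N c B _ (λ s len → cT≤B (x ∷ s) (cong suc len))))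
  (≤-reflexive (sym (*-assoc N (N ^ n) B)))

cubeSum-seqSum : ∀ K n N (T : List ℕ → Vec Bool K → ℕ) →
  cubeSum K (λ v → seqSum n N (λ s → T s v)) ≡ seqSum n N (λ s → cubeSum K (T s))
cubeSum-seqSum K zero    N T = refl
cubeSum-seqSum K (suc n) N T =
  trans (cubeSum-rangeSum K N (λ x v → seqSum n N (λ s → T (x ∷ s) v)))
        (rangeSum-cong N (λ x → cubeSum-seqSum K n N (λ s → T (x ∷ s))))

at : List ℕ → ℕ → ℕ
at []      _       = 0
at (x ∷ s) zero    = x
at (x ∷ s) (suc i) = at s i

at-∈ : ∀ s {i} → i < length s → at s i ∈ s
at-∈ (x ∷ s) {zero}  _         = here refl
at-∈ (x ∷ s) {suc i} (s≤s i<n) = there (at-∈ s i<n)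

at-< : ∀ {s} → Linked _<_ s → ∀ {i j} → i < j → j < length s → at s i < at s j
at-< [-]         {zero}  {suc j}       _         (s≤s ())
at-< (x<y ∷ _)   {zero}  {suc zero}    _         _         = x<y
at-< (x<y ∷ s↗)  {zero}  {suc (suc j)} _         (s≤s j<n) = <-trans x<y (at-< s↗ {zero} {suc j} z<s j<n)
at-< (_ ∷ s↗)    {suc i} {suc j}       (s≤s i<j) (s≤s j<n) = at-< s↗ i<j j<n

at-injective : ∀ {s} → Linked _<_ s → ∀ {i j} → i < length s → j < length s → at s i ≡ at s j → i ≡ j
at-injective s↗ {i} {j} i<n j<n sᵢ≡sⱼ with <-cmp i j
... | tri< i<j _ _ = ⊥-elim (<-irrefl sᵢ≡sⱼ (at-< s↗ i<j j<n))
... | tri≈ _ i≡j _ = i≡j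
... | tri> _ _ j<i = ⊥-elim (<-irrefl (sym sᵢ≡sⱼ) (at-< s↗ j<i i<n))

linked-≤∧unique⇒linked-< : ∀ {s} → Linked _≤_ s → ListUnique.Unique s → Linked _<_ s
linked-≤∧unique⇒linked-< []        _                  = []
linked-≤∧unique⇒linked-< [-]       _                  = [-]
linked-≤∧unique⇒linked-< (x≤y ∷ s↗) ((x≢y ∷ _) ∷ s!) = ≤∧≢⇒< x≤y x≢y ∷ linked-≤∧unique⇒linked-< s↗ s!

record SortedImage {n} (A : Fin n → ℕ) : Set where
  field
    list       : List ℕ
    length≡n   : length list ≡ n
    increasing : Linked _<_ list
    ⊆-image    : ∀ {x} → x ∈ list → ∃[ i ] x ≡ A i

sortedImage : ∀ {n} (A : Fin n → ℕ) → Injective _≡_ _≡_ A → SortedImage A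
sortedImage A A-injective = record
  { list       = sort image
  ; length≡n   = trans (↭-length (sort-↭ image)) (length-tabulate A)
  ; increasing = linked-≤∧unique⇒linked-< (sort-↗ image)
      (SetoidPermutationProperties.Unique-resp-↭ (setoid ℕ)
        (SetoidPermutation.↭-sym (setoid ℕ) (SortingAlgorithm.sort-↭ₛ sortingAlgorithm image))
        (tabulate⁺ A-injective))
  ; ⊆-image    = λ x∈sorted → ∈-tabulate⁻ (∈-resp-↭ (sort-↭ image) x∈sorted)
  }
  where image = List.tabulate A

data Edge : Set where
  ij ik jk jl kl : Edge

edges : Vec Edge 5
edges = ik ∷ jl ∷ ij ∷ jk ∷ kl ∷ []

edges-unique : Unique edges
edges-unique = ((λ ()) ∷ (λ ()) ∷ (λ ()) ∷ (λ ()) ∷ [])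
             ∷ ((λ ()) ∷ (λ ()) ∷ (λ ()) ∷ [])
             ∷ ((λ ()) ∷ (λ ()) ∷ [])
             ∷ ((λ ()) ∷ [])
             ∷ []
             ∷ []

-- For a, b < m the four positions lie in the windows [0,m), [m,2m), [2m,4m), [4m,7m);
-- the gaps m + a and 2m + b between them let one read (a, b) back off any two of them.
module Quadruple (m : ℕ) where

  pos-i pos-j pos-k pos-l : ℕ → ℕ → ℕ
  pos-i a b = a
  pos-j a b = m + b
  pos-k a b = pos-j a b + (m + a)
  pos-l a b = pos-k a b + ((m + m) + b)

  endpoints : ℕ → ℕ → Edge → ℕ × ℕ
  endpoints a b ij = pos-i a b , pos-j a b
  endpoints a b ik = pos-i a b , pos-k a b
  endpoints a b jk = pos-j a b , pos-k a b
  endpoints a b jl = pos-j a b , pos-l a b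
  endpoints a b kl = pos-k a b , pos-l a b

  decode : ℕ × ℕ → ℕ × ℕ × Edge
  decode (p , q) =
    if does (p <? m) then
      (if does (q <? m + m) then (p , q ∸ m , ij) else (p , (q ∸ (m + p)) ∸ m , ik))
    else if does (p <? m + m) then
      (if does (q <? (m + m) + (m + m)) then ((q ∸ p) ∸ m , p ∸ m , jk)
       else (((q ∸ ((m + m) + (p ∸ m))) ∸ p) ∸ m , p ∸ m , jl))
    else (let b = (q ∸ p) ∸ (m + m) in (p ∸ (m + b)) ∸ m , b , kl)

  module _ {a b : ℕ} (a<m : a < m) (b<m : b < m) where

    pos-j-window : m ≤ pos-j a b × pos-j a b < m + m
    pos-j-window = m≤m+n m b , +-monoʳ-< m b<m

    pos-k-window : m + m ≤ pos-k a b × pos-k a b < (m + m) + (m + m)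
    pos-k-window = +-mono-≤ (m≤m+n m b) (m≤m+n m a) , +-mono-< (+-monoʳ-< m b<m) (+-monoʳ-< m a<m)

    pos-l-window : (m + m) + (m + m) ≤ pos-l a b × pos-l a b < ((m + m) + (m + m)) + ((m + m) + m)
    pos-l-window = +-mono-≤ (proj₁ pos-k-window) (m≤m+n (m + m) b)
                 , +-mono-< (proj₂ pos-k-window) (+-monoʳ-< (m + m) b<m)

    decode-endpoints : ∀ e → decode (endpoints a b e) ≡ (a , b , e)
    decode-endpoints ij
      rewrite dec-true (a <? m) a<m | dec-true (m + b <? m + m) (proj₂ pos-j-window)
            | m+n∸m≡n m b = refl
    decode-endpoints ik
      rewrite dec-true (a <? m) a<m | dec-false (pos-k a b <? m + m) (≤⇒≯ (proj₁ pos-k-window))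
            | m+n∸n≡m (m + b) (m + a) | m+n∸m≡n m b = refl
    decode-endpoints jk
      rewrite dec-false (m + b <? m) (≤⇒≯ (proj₁ pos-j-window))
            | dec-true (m + b <? m + m) (proj₂ pos-j-window)
            | dec-true (pos-k a b <? (m + m) + (m + m)) (proj₂ pos-k-window)
            | m+n∸m≡n (m + b) (m + a) | m+n∸m≡n m a | m+n∸m≡n m b = refl
    decode-endpoints jl
      rewrite dec-false (m + b <? m) (≤⇒≯ (proj₁ pos-j-window))
            | dec-true (m + b <? m + m) (proj₂ pos-j-window)
            | dec-false (pos-l a b <? (m + m) + (m + m)) (≤⇒≯ (proj₁ pos-l-window))
            | m+n∸m≡n m b | m+n∸n≡m (pos-k a b) ((m + m) + b)
            | m+n∸m≡n (m + b) (m + a) | m+n∸m≡n m a = refl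
    decode-endpoints kl
      rewrite dec-false (pos-k a b <? m) (≤⇒≯ (≤-trans (m≤m+n m m) (proj₁ pos-k-window)))
            | dec-false (pos-k a b <? m + m) (≤⇒≯ (proj₁ pos-k-window))
            | m+n∸m≡n (pos-k a b) ((m + m) + b) | m+n∸m≡n (m + m) b
            | m+n∸m≡n (m + b) (m + a) | m+n∸m≡n m a = refl

    pos-increasing : pos-i a b < pos-j a b × pos-j a b < pos-k a b × pos-k a b < pos-l a b × pos-l a b < 7 * m
    pos-increasing = <-≤-trans a<m (proj₁ pos-j-window)
               , <-≤-trans (proj₂ pos-j-window) (proj₁ pos-k-window)
               , <-≤-trans (proj₂ pos-k-window) (proj₁ pos-l-window)
               , <-≤-trans (proj₂ pos-l-window) (≤-reflexive (seven-windows m))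
      where
      seven-windows : ∀ m → ((m + m) + (m + m)) + ((m + m) + m) ≡ 7 * m
      seven-windows = solve-∀

    endpoints-increasing : ∀ e → proj₁ (endpoints a b e) < proj₂ (endpoints a b e)
                               × proj₂ (endpoints a b e) < 7 * m
    endpoints-increasing e with pos-increasing
    ... | i<j , j<k , k<l , l<7m with e
    ...   | ij = i<j                    , <-trans j<k (<-trans k<l l<7m)
    ...   | ik = <-trans i<j j<k        , <-trans k<l l<7m
    ...   | jk = j<k                    , <-trans k<l l<7m
    ...   | jl = <-trans j<k k<l        , l<7m
    ...   | kl = k<l                    , l<7m

  endpoints-injective : ∀ {a b a′ b′ e e′} → a < m → b < m → a′ < m → b′ < m →
    endpoints a b e ≡ endpoints a′ b′ e′ → (a , b , e) ≡ (a′ , b′ , e′)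
  endpoints-injective {e = e} {e′} a<m b<m a′<m b′<m same =
    trans (sym (decode-endpoints a<m b<m e)) (trans (cong decode same) (decode-endpoints a′<m b′<m e′))

pairIndex : ℕ → ℕ → ℕ → ℕ
pairIndex N x y = x * N + y

pairIndex-<-[1+x]*N : ∀ {N x y} → y < N → pairIndex N x y < suc x * N
pairIndex-<-[1+x]*N {N} {x} y<N = <-≤-trans (+-monoʳ-< (x * N) y<N) (≤-reflexive (+-comm (x * N) N))

pairIndex-< : ∀ {N x y} → x < N → y < N → pairIndex N x y < N * N
pairIndex-< {N} {x} x<N y<N = <-≤-trans (pairIndex-<-[1+x]*N {N} {x} y<N) (*-monoˡ-≤ N x<N)

pairIndex-<-pairIndex : ∀ {N x y x′ y′} → y < N → x < x′ → pairIndex N x y < pairIndex N x′ y′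
pairIndex-<-pairIndex {N} {x} {x′ = x′} {y′} y<N x<x′ =
  <-≤-trans (pairIndex-<-[1+x]*N {N} {x} y<N) (≤-trans (*-monoˡ-≤ N x<x′) (m≤m+n (x′ * N) y′))

pairIndex-injective : ∀ {N x y x′ y′} → y < N → y′ < N →
  pairIndex N x y ≡ pairIndex N x′ y′ → x ≡ x′ × y ≡ y′
pairIndex-injective {N} {x} {y} {x′} {y′} y<N y′<N same with <-cmp x x′
... | tri< x<x′ _ _ = ⊥-elim (<-irrefl same (pairIndex-<-pairIndex y<N x<x′))
... | tri≈ _ refl _ = refl , +-cancelˡ-≡ (x * N) y y′ same
... | tri> _ _ x′<x = ⊥-elim (<-irrefl (sym same) (pairIndex-<-pairIndex y′<N x′<x))

colourOf : Bool → Colour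
colourOf true  = red
colourOf false = blue

colouring : ∀ {K} → ℕ → Vec Bool K → Colouring
colouring N v x y = colourOf (bit v (pairIndex N x y))

missesPattern : Vec Bool 5 → ℕ
missesPattern (true ∷ true ∷ false ∷ false ∷ false ∷ []) = 0
missesPattern _                                          = 1

missesPattern≡0 : ∀ {r₁ r₂ b₁ b₂ b₃} → missesPattern (r₁ ∷ r₂ ∷ b₁ ∷ b₂ ∷ b₃ ∷ []) ≡ 0 →
  r₁ ≡ true × r₂ ≡ true × b₁ ≡ false × b₂ ≡ false × b₃ ≡ false
missesPattern≡0 {true} {true} {false} {false} {false} _ = refl , refl , refl , refl , refl
missesPattern≡0 {true} {true} {false} {false} {true}  ()
missesPattern≡0 {true} {true} {false} {true}          ()
missesPattern≡0 {true} {true} {true}                  ()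
missesPattern≡0 {true} {false}                        ()
missesPattern≡0 {false}                               ()

Pattern : Colouring → ℕ → ℕ → ℕ → ℕ → Set
Pattern φ a b c d =
  (a < b) × (b < c) × (c < d) ×
  (φ a c ≡ red) × (φ b d ≡ red) × (φ a b ≡ blue) × (φ b c ≡ blue) × (φ c d ≡ blue)

Pattern⇒HasPattern : ∀ {φ n} {A : Fin n → ℕ} {a b c d} → Pattern φ a b c d →
  ∃[ i ] a ≡ A i → ∃[ j ] b ≡ A j → ∃[ k ] c ≡ A k → ∃[ l ] d ≡ A l → HasPattern φ n A
Pattern⇒HasPattern abcd (i , refl) (j , refl) (k , refl) (l , refl) = i , j , k , l , abcd

product≡0⇒Any≡0 : ∀ {ns} → product ns ≡ 0 → Any (_≡ 0) ns
product≡0⇒Any≡0 {[]} ()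
product≡0⇒Any≡0 {n ∷ ns} ≡0 with m*n≡0⇒m≡0∨n≡0 n ≡0
... | inj₁ n≡0    = here n≡0
... | inj₂ rest≡0 = there (product≡0⇒Any≡0 rest≡0)

length-cartesianProduct : ∀ {A B : Set} (xs : List A) (ys : List B) →
  length (cartesianProduct xs ys) ≡ length xs * length ys
length-cartesianProduct []       ys = refl
length-cartesianProduct (x ∷ xs) ys = begin
  length (List.map (x ,_) ys ++ cartesianProduct xs ys)
    ≡⟨ length-++ (List.map (x ,_) ys) ⟩
  length (List.map (x ,_) ys) + length (cartesianProduct xs ys)
    ≡⟨ cong₂ _+_ (length-map (x ,_) ys) (length-cartesianProduct xs ys) ⟩
  length ys + length xs * length ys ∎
  where open ≡-Reasoning

IncreasingBelow : ℕ → List ℕ → Set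
IncreasingBelow N s = Linked _<_ s × All (_< N) s

increasingBelow? : ∀ N s → Dec (IncreasingBelow N s)
increasingBelow? N s = linked? _<?_ s ×-dec All.all? (_<? N) s

module Construction (n N m : ℕ) (7m≤n : 7 * m ≤ n) where

  open Quadruple m

  K : ℕ
  K = N * N

  indices : List (Fin m × Fin m)
  indices = cartesianProduct (allFin m) (allFin m)

  positions : Fin m × Fin m → Edge → ℕ × ℕ
  positions (a , b) = endpoints (toℕ a) (toℕ b)

  coordinate : List ℕ → Fin m × Fin m → Edge → ℕ
  coordinate s ab e = pairIndex N (at s (proj₁ (positions ab e))) (at s (proj₂ (positions ab e)))

  block : List ℕ → Fin m × Fin m → Vec ℕ 5
  block s ab = Vec.map (coordinate s ab) edges

  blocks : List ℕ → List (Vec ℕ 5)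
  blocks s = List.map (block s) indices

  bad : List ℕ → Vec Bool K → ℕ
  bad s v = if does (increasingBelow? N s) then blockProduct missesPattern (blocks s) v else 0

  badCount : Vec Bool K → ℕ
  badCount v = seqSum n N (λ s → bad s v)

  positions-injective : ∀ {ab ab′ e e′} → positions ab e ≡ positions ab′ e′ → ab ≡ ab′ × e ≡ e′
  positions-injective {a , b} {a′ , b′} same =
    let a≡a′ , b,e≡b′,e′ = ,-injective (endpoints-injective (toℕ<n a) (toℕ<n b) (toℕ<n a′) (toℕ<n b′) same)
        b≡b′ , e≡e′      = ,-injective b,e≡b′,e′
    in cong₂ _,_ (toℕ-injective a≡a′) (toℕ-injective b≡b′) , e≡e′

  bad-increasingBelow : ∀ {s} → IncreasingBelow N s → ∀ v → bad s v ≡ blockProduct missesPattern (blocks s) v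
  bad-increasingBelow {s} s↗<N v rewrite dec-true (increasingBelow? N s) s↗<N = refl

  bad-¬increasingBelow : ∀ {s} → ¬ IncreasingBelow N s → ∀ v → bad s v ≡ 0
  bad-¬increasingBelow {s} ¬s↗<N v rewrite dec-false (increasingBelow? N s) ¬s↗<N = refl

  module _ {s : List ℕ} (s↗ : Linked _<_ s) (s<N : All (_< N) s) (|s|≡n : length s ≡ n) where

    <n⇒<|s| : ∀ {p} → p < n → p < length s
    <n⇒<|s| = subst (_ <_) (sym |s|≡n)

    at<N : ∀ {p} → p < n → at s p < N
    at<N p<n = All.lookup s<N (at-∈ s (<n⇒<|s| p<n))

    positions-< : ∀ ab e → proj₁ (positions ab e) < proj₂ (positions ab e) × proj₂ (positions ab e) < n
    positions-< (a , b) e =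
      let p<q , q<7m = endpoints-increasing (toℕ<n a) (toℕ<n b) e in p<q , <-≤-trans q<7m 7m≤n

    coordinate-< : ∀ ab e → coordinate s ab e < K
    coordinate-< ab e = let p<q , q<n = positions-< ab e in pairIndex-< (at<N (<-trans p<q q<n)) (at<N q<n)

    at-injective-<n : ∀ {p p′} → p < n → p′ < n → at s p ≡ at s p′ → p ≡ p′
    at-injective-<n p<n p′<n = at-injective s↗ (<n⇒<|s| p<n) (<n⇒<|s| p′<n)

    coordinate-injective : ∀ {ab ab′ e e′} → coordinate s ab e ≡ coordinate s ab′ e′ → ab ≡ ab′ × e ≡ e′
    coordinate-injective {ab} {ab′} {e} {e′} same =
      let p<q , q<n         = positions-< ab e
          p′<q′ , q′<n       = positions-< ab′ e′
          sₚ≡sₚ′ , s_q≡s_q′ = pairIndex-injective (at<N q<n) (at<N q′<n) same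
      in positions-injective (cong₂ _,_ (at-injective-<n (<-trans p<q q<n) (<-trans p′<q′ q′<n) sₚ≡sₚ′)
                                        (at-injective-<n q<n q′<n s_q≡s_q′))

    block-unique : ∀ ab → Unique (block s ab)
    block-unique ab = VecUnique.map⁺ {f = coordinate s ab}
      (λ {e} {e′} → proj₂ ∘ coordinate-injective {ab} {ab} {e} {e′}) edges-unique

    blocks-disjoint : AllPairs Disjoint (blocks s)
    blocks-disjoint = AllPairsₚ.map⁺ (AllPairs.map apart (cartesianProduct⁺ (allFin⁺ m) (allFin⁺ m)))
      where
      apart : ∀ {ab ab′} → ab ≢ ab′ → Disjoint (block s ab) (block s ab′)
      apart {ab} {ab′} ab≢ab′ = VecAllₚ.map⁺ {f = coordinate s ab} (VecAll.universal (λ e →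
        VecAllₚ.map⁺ {f = coordinate s ab′} (VecAll.universal (λ e′ same →
          ab≢ab′ (proj₁ (coordinate-injective {ab} {ab′} {e} {e′} same))) edges)) edges)

    length-blocks : length (blocks s) ≡ m * m
    length-blocks = trans (length-map (block s) indices)
      (trans (length-cartesianProduct (allFin m) (allFin m))
             (cong₂ _*_ (length-tabulate {n = m} id) (length-tabulate {n = m} id)))

    cubeSum-blockProduct-missesPattern :
      32 ^ (m * m) * cubeSum K (blockProduct missesPattern (blocks s)) ≡ 31 ^ (m * m) * 2 ^ K
    cubeSum-blockProduct-missesPattern =
      subst (λ Q → 32 ^ Q * cubeSum K (blockProduct missesPattern (blocks s)) ≡ 31 ^ Q * 2 ^ K) length-blocks
        (cubeSum-blockProduct K missesPattern (blocks s)
          (Allₚ.map⁺ (All.universal (λ ab → VecAllₚ.map⁺ (VecAll.universal (coordinate-< ab) edges)) indices))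
          (Allₚ.map⁺ (All.universal block-unique indices))
          blocks-disjoint)

    block-forces-pattern : ∀ {A : Fin n → ℕ} → (∀ {x} → x ∈ s → ∃[ i ] x ≡ A i) →
      ∀ (v : Vec Bool K) ab → missesPattern (restrict v (block s ab)) ≡ 0 → HasPattern (colouring N v) n A
    block-forces-pattern {A} s⊆A v (a , b) ≡0
      with pos-increasing (toℕ<n a) (toℕ<n b) | missesPattern≡0 ≡0
    ... | i<j , j<k , k<l , l<7m | r₁ , r₂ , b₁ , b₂ , b₃ =
      Pattern⇒HasPattern {φ = colouring N v}
        (at-< s↗ i<j (<n⇒<|s| j<n) , at-< s↗ j<k (<n⇒<|s| k<n) , at-< s↗ k<l (<n⇒<|s| l<n) ,
         cong colourOf r₁ , cong colourOf r₂ , cong colourOf b₁ , cong colourOf b₂ , cong colourOf b₃)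
        (image i<n) (image j<n) (image k<n) (image l<n)
      where
      l<n : pos-l (toℕ a) (toℕ b) < n
      l<n = <-≤-trans l<7m 7m≤n
      k<n : pos-k (toℕ a) (toℕ b) < n
      k<n = <-trans k<l l<n
      j<n : pos-j (toℕ a) (toℕ b) < n
      j<n = <-trans j<k k<n
      i<n : pos-i (toℕ a) (toℕ b) < n
      i<n = <-trans i<j j<n
      image : ∀ {p} → p < n → ∃[ i ] at s p ≡ A i
      image p<n = s⊆A (at-∈ s (<n⇒<|s| p<n))

  Q : ℕ
  Q = m * m

  cubeSum-bad : ∀ s → length s ≡ n → 32 ^ Q * cubeSum K (bad s) ≤ 31 ^ Q * 2 ^ K
  cubeSum-bad s |s|≡n with increasingBelow? N s
  ... | yes s↗<N@(s↗ , s<N) = ≤-reflexive (begin-equality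
    32 ^ Q * cubeSum K (bad s)
      ≡⟨ cong (32 ^ Q *_) (cubeSum-cong K (bad-increasingBelow s↗<N)) ⟩
    32 ^ Q * cubeSum K (blockProduct missesPattern (blocks s))
      ≡⟨ cubeSum-blockProduct-missesPattern s↗ s<N |s|≡n ⟩
    31 ^ Q * 2 ^ K ∎)
    where open ≤-Reasoning
  ... | no ¬s↗<N = begin
    32 ^ Q * cubeSum K (bad s)    ≡⟨ cong (32 ^ Q *_) (cubeSum-cong K (bad-¬increasingBelow ¬s↗<N)) ⟩
    32 ^ Q * cubeSum K (λ _ → 0)  ≡⟨ cong (32 ^ Q *_) (cubeSum-0 K) ⟩
    32 ^ Q * 0                    ≡⟨ *-zeroʳ (32 ^ Q) ⟩
    0                             ≤⟨ z≤n ⟩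
    31 ^ Q * 2 ^ K                ∎
    where open ≤-Reasoning

  good-colouring : N ^ n * 31 ^ Q < 32 ^ Q → ∃[ v ] badCount v ≡ 0
  good-colouring Nⁿ31^Q<32^Q = cubeSum-<⇒∃≡0 K badCount (*-cancelˡ-< (32 ^ Q) _ _ (begin-strict
    32 ^ Q * cubeSum K badCount                    ≡⟨ cong (32 ^ Q *_) (cubeSum-seqSum K n N bad) ⟩
    32 ^ Q * seqSum n N (λ s → cubeSum K (bad s))  ≤⟨ *-seqSum-≤ n N (32 ^ Q) _ _ cubeSum-bad ⟩
    N ^ n * (31 ^ Q * 2 ^ K)                       ≡⟨ sym (*-assoc (N ^ n) _ _) ⟩
    N ^ n * 31 ^ Q * 2 ^ K                         <⟨ *-monoˡ-< (2 ^ K) ⦃ m^n≢0 2 K ⦄ Nⁿ31^Q<32^Q ⟩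
    32 ^ Q * 2 ^ K                                 ∎))
    where open ≤-Reasoning

  good-colouring-forces-pattern : ∀ (v : Vec Bool K) → badCount v ≡ 0 →
    ∀ (A : Fin n → ℕ) → IsNSubset N n A → HasPattern (colouring N v) n A
  good-colouring-forces-pattern v badCount≡0 A (A-injective , A<N) =
    let ab , block≡0 = Any.satisfied some-block≡0
    in block-forces-pattern increasing s<N length≡n ⊆-image v ab block≡0
    where
    open SortedImage (sortedImage A A-injective)
    s<N : All (_< N) list
    s<N = All.tabulate (λ x∈s → let i , x≡Aᵢ = ⊆-image x∈s in subst (_< N) (sym x≡Aᵢ) (A<N i))
    bad≡0 : bad list v ≡ 0
    bad≡0 = n≤0⇒n≡0 (≤-trans (≤-seqSum n N (λ s → bad s v) length≡n s<N) (≤-reflexive badCount≡0))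
    some-block≡0 : Any (λ ab → missesPattern (restrict v (block list ab)) ≡ 0) indices
    some-block≡0 =
      map⁻ (map⁻ (product≡0⇒Any≡0 (trans (sym (bad-increasingBelow (increasing , s<N) v)) bad≡0)))

  pattern-forcing-colouring : N ^ n * 31 ^ Q < 32 ^ Q →
    ∃[ φ ] (∀ (A : Fin n → ℕ) → IsNSubset N n A → HasPattern φ n A)
  pattern-forcing-colouring bound =
    let v , badCount≡0 = good-colouring bound in colouring N v , good-colouring-forces-pattern v badCount≡0

^-distribʳ-* : ∀ a b c → (a * b) ^ c ≡ a ^ c * b ^ c
^-distribʳ-* a b zero    = refl
^-distribʳ-* a b (suc c) = trans (cong (a * b *_) (^-distribʳ-* a b c)) (interchange′ a b (a ^ c) (b ^ c))
  where
  interchange′ : ∀ a b x y → a * b * (x * y) ≡ a * x * (b * y)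
  interchange′ = solve-∀

^-*-regroup : ∀ x a b c d → a * b ≡ c * d → (x ^ a) ^ b ≡ (x ^ c) ^ d
^-*-regroup x a b c d ab≡cd = trans (^-*-assoc x a b) (trans (cong (x ^_) ab≡cd) (sym (^-*-assoc x c d)))

^-reflectsˡ-< : ∀ a b k → a ^ k < b ^ k → a < b
^-reflectsˡ-< a b k aᵏ<bᵏ = ≰⇒> (λ b≤a → <⇒≱ aᵏ<bᵏ (^-monoˡ-≤ k b≤a))

-- 4312 = 22 · 14²: the 4312th power of N^n is at most 2^(n²) < 2^(196 m²), which 2 · 31²² ≤ 32²² absorbs.
Nⁿ31^m²<32^m² : ∀ n N m → n < 14 * m → N ^ 4312 ≤ 2 ^ n → N ^ n * 31 ^ (m * m) < 32 ^ (m * m)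
Nⁿ31^m²<32^m² n N m n<14m N^4312≤2ⁿ = ^-reflectsˡ-< (N ^ n * 31 ^ Q) (32 ^ Q) 4312 (begin-strict
  (N ^ n * 31 ^ Q) ^ 4312               ≡⟨ ^-distribʳ-* (N ^ n) (31 ^ Q) 4312 ⟩
  (N ^ n) ^ 4312 * (31 ^ Q) ^ 4312      ≡⟨ cong₂ _*_ (^-*-regroup N n 4312 4312 n (*-comm n 4312))
                                                     (^-*-regroup 31 Q 4312 22 R (Q*4312≡22*R Q)) ⟩
  (N ^ 4312) ^ n * (31 ^ 22) ^ R        ≤⟨ *-monoˡ-≤ ((31 ^ 22) ^ R) (^-monoˡ-≤ n N^4312≤2ⁿ) ⟩
  (2 ^ n) ^ n * (31 ^ 22) ^ R           ≡⟨ cong (_* (31 ^ 22) ^ R) (^-*-assoc 2 n n) ⟩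
  2 ^ (n * n) * (31 ^ 22) ^ R           <⟨ *-monoˡ-< ((31 ^ 22) ^ R) ⦃ m^n≢0 (31 ^ 22) R ⦄
                                                     (^-monoʳ-< 2 (s≤s (s≤s z≤n)) n²<R) ⟩
  2 ^ R * (31 ^ 22) ^ R                 ≡⟨ sym (^-distribʳ-* 2 (31 ^ 22) R) ⟩
  (2 * 31 ^ 22) ^ R                     ≤⟨ ^-monoˡ-≤ R (≤ᵇ⇒≤ (2 * 31 ^ 22) (32 ^ 22) tt) ⟩
  (32 ^ 22) ^ R                         ≡⟨ ^-*-regroup 32 22 R Q 4312 (sym (Q*4312≡22*R Q)) ⟩
  (32 ^ Q) ^ 4312                       ∎)
  where
  open ≤-Reasoning
  Q R : ℕ
  Q = m * m
  R = 196 * Q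
  Q*4312≡22*R : ∀ Q → Q * 4312 ≡ 22 * (196 * Q)
  Q*4312≡22*R = solve-∀
  [14m]²≡196m² : ∀ m → 14 * m * (14 * m) ≡ 196 * (m * m)
  [14m]²≡196m² = solve-∀
  n²<R : n * n < R
  n²<R = <-≤-trans (*-mono-< n<14m n<14m) (≤-reflexive ([14m]²≡196m² m))

n<14*[n/7] : ∀ {n} → 7 ≤ n → n < 14 * (n / 7)
n<14*[n/7] {n} 7≤n = begin-strict
  n                          ≡⟨ m≡m%n+[m/n]*n n 7 ⟩
  n % 7 + n / 7 * 7          <⟨ +-monoˡ-< (n / 7 * 7) (m%n<n n 7) ⟩
  7 + n / 7 * 7              ≤⟨ +-monoˡ-≤ (n / 7 * 7) (*-monoˡ-≤ 7 (m≥n⇒m/n>0 7≤n)) ⟩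
  n / 7 * 7 + n / 7 * 7      ≡⟨ double (n / 7) ⟩
  14 * (n / 7)               ∎
  where
  open ≤-Reasoning
  double : ∀ m → m * 7 + m * 7 ≡ 14 * m
  double = solve-∀

n<7⇒N≤1 : ∀ {n N} → n < 7 → N ^ 4312 ≤ 2 ^ n → N ≤ 1
n<7⇒N≤1 {n} {N} n<7 N^4312≤2ⁿ =
  s≤s⁻¹ (^-reflectsˡ-< N 2 4312 (≤-<-trans N^4312≤2ⁿ (^-monoʳ-< 2 (s≤s (s≤s z≤n)) n<4312)))
  where
  n<4312 : n < 4312
  n<4312 = <-≤-trans n<7 (m≤m+n 7 4305)

N≤1⇒¬IsNSubset : ∀ {n N} {A : Fin (suc (suc n)) → ℕ} → N ≤ 1 → ¬ IsNSubset N (suc (suc n)) A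
N≤1⇒¬IsNSubset {A = A} N≤1 (A-injective , A<N)
  with A-injective (trans (A≡0 fzero) (sym (A≡0 (fsuc fzero))))
  where
  A≡0 : ∀ i → A i ≡ 0
  A≡0 i = n<1⇒n≡0 (<-≤-trans (A<N i) N≤1)
... | ()

lemma4p1 : ∃[ p ] ∃[ q ] (1 ≤ p) × (1 ≤ q) ×
             (∀ (n N : ℕ) → 5 ≤ n → IsFloorPow2 p q n N →
               ∃[ φ ] (∀ (A : Fin n → ℕ) → IsNSubset N n A → HasPattern φ n A))
lemma4p1 = 1 , 4312 , s≤s z≤n , s≤s z≤n , λ n N 5≤n (N^4312≤2ⁿ , _) →
  colouring-for n N 5≤n (subst (λ e → N ^ 4312 ≤ 2 ^ e) (*-identityˡ n) N^4312≤2ⁿ)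
  where
  colouring-for : ∀ n N → 5 ≤ n → N ^ 4312 ≤ 2 ^ n →
    ∃[ φ ] (∀ (A : Fin n → ℕ) → IsNSubset N n A → HasPattern φ n A)
  colouring-for n@(suc (suc _)) N (s≤s (s≤s _)) N^4312≤2ⁿ with 7 ≤? n
  ... | yes 7≤n = Construction.pattern-forcing-colouring n N (n / 7) 7[n/7]≤n
                    (Nⁿ31^m²<32^m² n N (n / 7) (n<14*[n/7] 7≤n) N^4312≤2ⁿ)
    where
    7[n/7]≤n : 7 * (n / 7) ≤ n
    7[n/7]≤n = ≤-trans (≤-reflexive (*-comm 7 (n / 7))) (m/n*n≤m n 7)
  ... | no 7≰n =
    (λ _ _ → red) , λ A A-subset → ⊥-elim (N≤1⇒¬IsNSubset (n<7⇒N≤1 (≰⇒> 7≰n) N^4312≤2ⁿ) A-subset)
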